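{- Let $\mathfrak E=(\hat N,\mathcal N,d,\Theta)$ be an EOS satisfying the standing assumptions below, and let $e=(t,\theta)\in\Theta$. If $m$ and $m'$ are configurations of $\mathfrak E$ and $k$ is a configuration of $\mathfrak E^{cons}$ over the trash places such that $m\to^{e^{cons}}m'+k$ in $\mathfrak E^{cons}$, then there is a configuration $m''$ of $\mathfrak E$ such that $m\ge_f m''$ and $m''\to^{e}m'$ in $\mathfrak E$.
   Context: EOS: A PN is $(P,T,F)$ with $F:(P\times T)\cup(T\times P)\to\mathbb N$, ${\tt pre}_N(t)(p)=F(p,t)$, ${\tt post}_N(t)(p)=F(t,p)$; $\blacksquare=(\emptyset,\emptyset,\emptyset)$ with unique marking $\varepsilon$. An EOS is $(\hat N,\mathcal N,d,\Theta)$: system PN $\hat N=(\hat P,\hat T,\hat F)$ containing idle transitions $id_p$ ($p\in\hat P$) consuming and producing one token on $p$ only; finite set $\mathcal N\ni\blacksquare$ of object PNs, all nets pairwise disjoint; typing $d:\hat P\to\mathcal N$; finite event set $\Theta$ of pairs $(\hat\tau,\theta)$, $\hat\tau\in\hat T$, $\theta(N)$ a finite multiset of transitions of $N$, with $\theta(d(p))\ne\emptyset$ if $\hat\tau=id_p$. Configurations: finite multisets of nested tokens $(\hat p,m)$, $m$ a marking of $d(\hat p)$. With $\Pi^1(\sum_i(\hat p_i,m_i))=\sum_i\hat p_i$, $\Pi^2_N(\sum_i(\hat p_i,m_i))=\sum_{d(\hat p_i)=N}m_i$: event $(\hat\tau,\theta)$ fires on $\mu$ with mode $(\lambda,\rho)$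 iff $\lambda\sqsubseteq\mu$, $\Pi^1(\lambda)={\tt pre}_{\hat N}(\hat\tau)$, $\Pi^1(\rho)={\tt post}_{\hat N}(\hat\tau)$, and for all $N$: $\Pi^2_N(\lambda)\ge{\tt pre}_N(\theta(N))$, $\Pi^2_N(\rho)=\Pi^2_N(\lambda)-{\tt pre}_N(\theta(N))+{\tt post}_N(\theta(N))$; result $\mu-\lambda+\rho$. $\mu\le_f\mu'$ iff $\mu'$ arises from $\mu$ by adding tokens inside existing nested tokens and/or adding nested tokens. An event is system autonomous if $\theta(N)=\emptyset$ for all $N$. $t\in\hat T$ destroys type $N$ if $\hat F(p,t)\ne0$ for some $p$ with $d(p)=N$ and $\hat F(t,q)=0$ for all $q$ with $d(q)=N$; $\mathit{destroy}(t)$ is the set of such $N$. Standing assumptions on $\mathfrak E$: every $t\in\hat T$ occurs in exactly one event of $\Theta$, and if $\mathit{destroy}(t)\ne\emptyset$ that event is system autonomous. Conservative closure: $\mathfrak E^{cons}=(\hat N^{cons},\mathcal N,d^{cons},\Theta)$ with $\hat N^{cons}=(\hat P\cup\{\mathit{trash}_N:N\in\mathcal N\},\hat T,\hat F^{cons})$ (new places $\mathit{trash}_N$), $\hat F^{cons}(p,t)=\hat F(p,t)$ (zero on trash places), $\hat F^{cons}(t,p)=\hat F(t,p)$ for $p\in\hat P$, $\hat F^{cons}(t,\mathit{trash}_N)=1$ iff $N\in\mathit{destroy}(t)$ (else $0$); $d^{cons}$ extends $d$ by $d^{cons}(\mathit{trash}_N)=N$. $e^{cons}$ is the event $e$ in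 $\mathfrak E^{cons}$. A configuration of $\mathfrak E^{cons}$ is over the trash places if all its nested tokens lie on trash places. -}

module Defs where

open import Data.Nat as ℕ using (ℕ; zero; suc; _+_; _*_; _∸_; _≤_)
open import Data.Fin as Fin using (Fin)
open import Data.Fin.Properties using (any?; all?)
open import Data.Vec using (Vec; lookup)
open import Data.List using (List; []; _∷_; _++_; map)
open import Data.List.Relation.Unary.All using (All)
open import Data.List.Relation.Binary.Pointwise using (Pointwise)
open import Data.List.Relation.Binary.Permutation.Propositional using (_↭_)
open import Data.Product using (Σ; ∃; ∃-syntax; _×_; _,_; proj₁; proj₂)
open import Data.Sum using (_⊎_; inj₁; inj₂)
open import Data.Bool using (if_then_else_)
open import Relation.Nullary using (¬_; Dec; yes; no)
open import Relation.Nullary.Decidable using (⌊_⌋; _×-dec_; _→-dec_; ¬?)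
open import Relation.Binary.PropositionalEquality using (_≡_; _≢_; subst; refl)
open import Relation.Binary.Definitions using (DecidableEquality)

∑ : (n : ℕ) → (Fin n → ℕ) → ℕ
∑ zero    f = 0
∑ (suc n) f = f Fin.zero + ∑ n (λ i → f (Fin.suc i))

δ : {A : Set} → DecidableEquality A → A → A → ℕ
δ _≟_ a b = if ⌊ a ≟ b ⌋ then 1 else 0

-- The finite family 𝒩 of object Petri nets, indexed by Fin nn.
-- Net N has places Fin (pl N), transitions Fin (tr N); nets with
-- different indices are disjoint by construction.

record ObjNets : Set where
  field
    nn    : ℕ
    pl    : Fin nn → ℕ
    tr    : Fin nn → ℕ
    Fpt   : (N : Fin nn) → Fin (pl N) → Fin (tr N) → ℕ
    Ftp   : (N : Fin nn) → Fin (tr N) → Fin (pl N) → ℕ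

  Marking : Fin nn → Set
  Marking N = Vec ℕ (pl N)

  preM : (N : Fin nn) → (Fin (tr N) → ℕ) → Fin (pl N) → ℕ
  preM N θ q = ∑ (tr N) (λ t → θ t * Fpt N q t)

  postM : (N : Fin nn) → (Fin (tr N) → ℕ) → Fin (pl N) → ℕ
  postM N θ q = ∑ (tr N) (λ t → θ t * Ftp N t q)

record Event (O : ObjNets) (T : Set) : Set where
  constructor ev
  open ObjNets O
  field
    tau   : T
    theta : (N : Fin nn) → Fin (tr N) → ℕ

module Semantics (O : ObjNets) {P T : Set} (_≟P_ : DecidableEquality P)
                 (d : P → Fin (ObjNets.nn O))
                 (Fi : P → T → ℕ) (Fo : T → P → ℕ) where
  open ObjNets O

  NToken : Set
  NToken = Σ P (λ p → Marking (d p))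

  -- configurations: finite multisets of nested tokens, represented as
  -- lists up to permutation (_↭_)
  Config : Set
  Config = List NToken

  Π¹ : Config → P → ℕ
  Π¹ []             p = 0
  Π¹ ((q , m) ∷ μ) p = δ _≟P_ q p + Π¹ μ p

  Π² : (N : Fin nn) → Config → Fin (pl N) → ℕ
  Π² N []             i = 0
  Π² N ((q , m) ∷ μ) i with d q Fin.≟ N
  ... | yes eq = lookup (subst Marking eq m) i + Π² N μ i
  ... | no  _  = Π² N μ i

  -- event e fires on μ with mode (λ , ρ), λ ⊑ μ witnessed by μ ↭ λ ++ ν,
  -- and the result μ - λ + ρ is ρ ++ ν (up to permutation).
  record FiresWith (μ : Config) (e : Event O T) (lam rho : Config) (μ' : Config) : Set where
    open Event e
    field
      rest     : Config
      sub      : μ ↭ lam ++ rest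
      result   : μ' ↭ rho ++ rest
      sys-pre  : ∀ p → Π¹ lam p ≡ Fi p tau
      sys-post : ∀ p → Π¹ rho p ≡ Fo tau p
      obj-en   : ∀ N i → preM N (theta N) i ≤ Π² N lam i
      obj-eff  : ∀ N i → Π² N rho i ≡ (Π² N lam i ∸ preM N (theta N) i) + postM N (theta N) i

  _─[_]→_ : Config → Event O T → Config → Set
  μ ─[ e ]→ μ' = ∃[ lam ] ∃[ rho ] FiresWith μ e lam rho μ'

  -- μ ≤_f μ' : μ' arises from μ by adding tokens inside existing nested
  -- tokens and/or adding new nested tokens.
  data _≤ₜ_ : NToken → NToken → Set where
    le : ∀ {p} {m m' : Marking (d p)} → (∀ i → lookup m i ≤ lookup m' i) → (p , m) ≤ₜ (p , m')

  _≤f_ : Config → Config → Set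
  μ ≤f μ' = ∃[ μ₁ ] ∃[ ν ] (Pointwise _≤ₜ_ μ μ₁ × μ' ↭ μ₁ ++ ν)

record EOS : Set₁ where
  field
    obj : ObjNets
  open ObjNets obj public
  field
    np  : ℕ
    nt  : ℕ
    Fi  : Fin np → Fin nt → ℕ
    Fo  : Fin nt → Fin np → ℕ
    idT       : Fin np → Fin nt
    idle-pre  : ∀ p q → Fi q (idT p) ≡ δ Fin._≟_ p q
    idle-post : ∀ p q → Fo (idT p) q ≡ δ Fin._≟_ p q
    blk    : Fin nn
    blk-pl : pl blk ≡ 0
    blk-tr : tr blk ≡ 0
    d   : Fin np → Fin nn
    ne  : ℕ
    Θ   : Fin ne → Event obj (Fin nt)
    idle-nonempty : ∀ i p → Event.tau (Θ i) ≡ idT p →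
                    ∃[ t ] Event.theta (Θ i) (d p) t ≢ 0

module _ (E : EOS) where
  open EOS E

  Destroys : Fin nt → Fin nn → Set
  Destroys t N = (∃[ p ] (d p ≡ N × Fi p t ≢ 0)) × (∀ q → d q ≡ N → Fo t q ≡ 0)

  destroys? : ∀ t N → Dec (Destroys t N)
  destroys? t N = any? (λ p → (d p Fin.≟ N) ×-dec ¬? (Fi p t ℕ.≟ 0))
             ×-dec all? (λ q → (d q Fin.≟ N) →-dec (Fo t q ℕ.≟ 0))

  SystemAutonomous : Event obj (Fin nt) → Set
  SystemAutonomous e = ∀ N t → Event.theta e N t ≡ 0

  StandingAssumptions : Set
  StandingAssumptions =
    (∀ t → ∃[ i ] (Event.tau (Θ i) ≡ t × (∀ j → Event.tau (Θ j) ≡ t → j ≡ i)))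
    × (∀ i N → Destroys (Event.tau (Θ i)) N → SystemAutonomous (Θ i))

  module Sem = Semantics obj Fin._≟_ d Fi Fo

  -- conservative closure 𝔈^cons: places Fin np ⊎ Fin nn (inj₂ N = trash_N)
  PCons : Set
  PCons = Fin np ⊎ Fin nn

  _≟c_ : DecidableEquality PCons
  inj₁ p ≟c inj₁ q with p Fin.≟ q
  ... | yes refl = yes refl
  ... | no  ne'  = no λ { refl → ne' refl }
  inj₁ p ≟c inj₂ N = no λ ()
  inj₂ N ≟c inj₁ q = no λ ()
  inj₂ N ≟c inj₂ M with N Fin.≟ M
  ... | yes refl = yes refl
  ... | no  ne'  = no λ { refl → ne' refl }

  dCons : PCons → Fin nn
  dCons (inj₁ p) = d p
  dCons (inj₂ N) = N

  FiCons : PCons → Fin nt → ℕ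
  FiCons (inj₁ p) t = Fi p t
  FiCons (inj₂ N) t = 0

  FoCons : Fin nt → PCons → ℕ
  FoCons t (inj₁ p) = Fo t p
  FoCons t (inj₂ N) = if ⌊ destroys? t N ⌋ then 1 else 0

  module SemCons = Semantics obj _≟c_ dCons FiCons FoCons

  embed : Sem.Config → SemCons.Config
  embed = map (λ x → (inj₁ (proj₁ x) , proj₂ x))

  OnTrash : SemCons.NToken → Set
  OnTrash x = ∃[ N ] (proj₁ x ≡ inj₂ N)

  OverTrash : SemCons.Config → Set
  OverTrash = All OnTrash

{-# OPTIONS --safe #-}
module Submission where

-- Deleting the trash tokens from a firing of e^cons gives almost a firing of e:
-- the system-net conditions and the object-net conditions for every type not
-- destroyed by t are untouched, since no trash place is an input of t and
-- trash_N is an output of t only when t destroys N.  For a type N destroyed by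
-- t the projected ρ holds no token of type N, while λ may carry tokens of type N
-- with nonempty markings.  But then e is system autonomous, so θ(N) = ∅, and
-- emptying those markings (a step down in ≤_f) repairs the mode.

open import Defs
open import Data.Fin using (Fin)
open import Data.List using (_++_)
open import Data.Product using (∃-syntax; _×_)

import Data.Fin as Fin
open import Data.Empty using (⊥-elim)
open import Data.List using ([]; _∷_; mapMaybe)
open import Data.List.Properties using (++-identityʳ; mapMaybe-++)
open import Data.List.Relation.Unary.All using ([]; _∷_)
open import Data.List.Relation.Binary.Pointwise using (Pointwise; []; _∷_; ++⁺)
open import Data.List.Relation.Binary.Pointwise.Properties using () renaming (refl to Pointwise-refl)
open import Data.List.Relation.Binary.Permutation.Propositional using (_↭_; ↭-refl; ↭-reflexive; ↭-trans)
open import Data.List.Relation.Binary.Permutation.Propositional.Properties using (mapMaybe-↭)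
open import Data.Maybe using (Maybe; just; nothing)
open import Data.Nat using (ℕ; zero; suc; _+_; _*_; _∸_; _≤_; z≤n)
open import Data.Nat.Properties using (≤-refl; m+n≡0⇒n≡0)
open import Data.Product using (_,_)
open import Data.Sum using (inj₁; inj₂)
open import Data.Vec using (Vec; lookup; replicate)
open import Data.Vec.Properties using (lookup-replicate)
open import Level using (0ℓ)
open import Relation.Binary.Definitions using (DecidableEquality)
open import Relation.Binary.PropositionalEquality
open import Relation.Nullary using (¬_; Dec; yes; no)
open import Relation.Unary using (Pred; Decidable)

δ-refl : {A : Set} (_≟_ : DecidableEquality A) (a : A) → δ _≟_ a a ≡ 1
δ-refl _≟_ a with a ≟ a
... | yes _ = refl
... | no a≢a = ⊥-elim (a≢a refl)

∑-zero : ∀ n (f : Fin n → ℕ) → (∀ j → f j ≡ 0) → ∑ n f ≡ 0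
∑-zero zero    f f≡0 = refl
∑-zero (suc n) f f≡0 rewrite f≡0 Fin.zero = ∑-zero n (λ j → f (Fin.suc j)) (λ j → f≡0 (Fin.suc j))

module _ (O : ObjNets) where
  open ObjNets O

  preM-zero : ∀ N θ → (∀ t → θ t ≡ 0) → ∀ q → preM N θ q ≡ 0
  preM-zero N θ θ≡0 q = ∑-zero (tr N) _ (λ t → cong (_* Fpt N q t) (θ≡0 t))

  postM-zero : ∀ N θ → (∀ t → θ t ≡ 0) → ∀ q → postM N θ q ≡ 0
  postM-zero N θ θ≡0 q = ∑-zero (tr N) _ (λ t → cong (_* Ftp N t q) (θ≡0 t))

emptyIf : {A : Set} {n : ℕ} → Dec A → Vec ℕ n → Vec ℕ n
emptyIf (yes _) v = replicate _ 0
emptyIf (no _)  v = v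

module SemanticsProperties (O : ObjNets) {P T : Set} (_≟P_ : DecidableEquality P)
                           (d : P → Fin (ObjNets.nn O))
                           (Fi : P → T → ℕ) (Fo : T → P → ℕ) where
  open ObjNets O
  open Semantics O _≟P_ d Fi Fo

  Π¹≡0⇒Π²≡0 : ∀ N μ → (∀ p → d p ≡ N → Π¹ μ p ≡ 0) → ∀ i → Π² N μ i ≡ 0
  Π¹≡0⇒Π²≡0 N []            _   i = refl
  Π¹≡0⇒Π²≡0 N ((q , m) ∷ μ) Π¹≡0 i with d q Fin.≟ N
  ... | yes dq≡N with () ← subst (λ n → n + Π¹ μ q ≡ 0) (δ-refl _≟P_ q) (Π¹≡0 q dq≡N)
  ... | no _ = Π¹≡0⇒Π²≡0 N μ (λ p dp≡N → m+n≡0⇒n≡0 (δ _≟P_ q p) (Π¹≡0 p dp≡N)) i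

  clear : {X : Pred (Fin nn) 0ℓ} → Decidable X → Config → Config
  clear X? []            = []
  clear X? ((p , m) ∷ μ) = (p , emptyIf (X? (d p)) m) ∷ clear X? μ

  module _ {X : Pred (Fin nn) 0ℓ} (X? : Decidable X) where

    Π¹-clear : ∀ μ p → Π¹ (clear X? μ) p ≡ Π¹ μ p
    Π¹-clear []            p = refl
    Π¹-clear ((q , m) ∷ μ) p = cong (δ _≟P_ q p +_) (Π¹-clear μ p)

    Π²-clear-∉ : ∀ N → ¬ X N → ∀ μ i → Π² N (clear X? μ) i ≡ Π² N μ i
    Π²-clear-∉ N ¬XN []            i = refl
    Π²-clear-∉ N ¬XN ((q , m) ∷ μ) i with d q Fin.≟ N
    ... | no _ = Π²-clear-∉ N ¬XN μ i
    ... | yes refl with X? (d q)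
    ...   | yes XN = ⊥-elim (¬XN XN)
    ...   | no _   = cong (lookup m i +_) (Π²-clear-∉ N ¬XN μ i)

    Π²-clear-∈ : ∀ N → X N → ∀ μ i → Π² N (clear X? μ) i ≡ 0
    Π²-clear-∈ N XN []            i = refl
    Π²-clear-∈ N XN ((q , m) ∷ μ) i with d q Fin.≟ N
    ... | no _ = Π²-clear-∈ N XN μ i
    ... | yes refl with X? (d q)
    ...   | yes _   = cong₂ _+_ (lookup-replicate i 0) (Π²-clear-∈ N XN μ i)
    ...   | no ¬XN  = ⊥-elim (¬XN XN)

    clear-≤ₜ : ∀ μ → Pointwise _≤ₜ_ (clear X? μ) μ
    clear-≤ₜ []            = []
    clear-≤ₜ ((p , m) ∷ μ) = le (emptyIf-≤ (X? (d p))) ∷ clear-≤ₜ μ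
      where
      emptyIf-≤ : (dec : Dec (X (d p))) → ∀ i → lookup (emptyIf dec m) i ≤ lookup m i
      emptyIf-≤ (yes _) i rewrite lookup-replicate i 0 = z≤n
      emptyIf-≤ (no _)  i = ≤-refl

    ≤f-clear : ∀ {μ lam rest} → μ ↭ lam ++ rest → (clear X? lam ++ rest) ≤f μ
    ≤f-clear {lam = lam} {rest} μ↭ =
      lam ++ rest , [] ,
      ++⁺ (clear-≤ₜ lam) (Pointwise-refl (le (λ _ → ≤-refl))) ,
      ↭-trans μ↭ (↭-reflexive (sym (++-identityʳ (lam ++ rest))))

module _ (E : EOS) where
  open EOS E
  private
    module S = Sem E
    module C = SemCons E
  open SemanticsProperties obj Fin._≟_ d Fi Fo

  fromSystemPlace : C.NToken → Maybe S.NToken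
  fromSystemPlace (inj₁ p , m) = just (p , m)
  fromSystemPlace (inj₂ _ , _) = nothing

  dropTrash : C.Config → S.Config
  dropTrash = mapMaybe fromSystemPlace

  dropTrash-embed : ∀ μ → dropTrash (embed E μ) ≡ μ
  dropTrash-embed []      = refl
  dropTrash-embed (x ∷ μ) = cong (x ∷_) (dropTrash-embed μ)

  dropTrash-overTrash : ∀ k → OverTrash E k → dropTrash k ≡ []
  dropTrash-overTrash []                  []             = refl
  dropTrash-overTrash ((inj₂ _ , _) ∷ k) (_ ∷ k-trash) = dropTrash-overTrash k k-trash

  dropTrash-embed-++ : ∀ μ k → OverTrash E k → dropTrash (embed E μ ++ k) ≡ μ
  dropTrash-embed-++ μ k k-trash = begin
    dropTrash (embed E μ ++ k)          ≡⟨ mapMaybe-++ fromSystemPlace (embed E μ) k ⟩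
    dropTrash (embed E μ) ++ dropTrash k ≡⟨ cong₂ _++_ (dropTrash-embed μ) (dropTrash-overTrash k k-trash) ⟩
    μ ++ []                              ≡⟨ ++-identityʳ μ ⟩
    μ                                    ∎
    where open ≡-Reasoning

  dropTrash-↭-++ : ∀ {μ lam rest} → μ ↭ lam ++ rest → dropTrash μ ↭ dropTrash lam ++ dropTrash rest
  dropTrash-↭-++ {lam = lam} {rest} μ↭ =
    ↭-trans (mapMaybe-↭ fromSystemPlace μ↭) (↭-reflexive (mapMaybe-++ fromSystemPlace lam rest))

  Π¹-dropTrash : ∀ μ p → S.Π¹ (dropTrash μ) p ≡ C.Π¹ μ (inj₁ p)
  Π¹-dropTrash []                  p = refl
  Π¹-dropTrash ((inj₁ q , m) ∷ μ) p = cong₂ _+_ (δ-inj₁ q) (Π¹-dropTrash μ p)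
    where
    δ-inj₁ : ∀ q → δ Fin._≟_ q p ≡ δ (_≟c_ E) (inj₁ q) (inj₁ p)
    δ-inj₁ q with q Fin.≟ p
    ... | yes refl = refl
    ... | no _     = refl
  Π¹-dropTrash ((inj₂ _ , _) ∷ μ) p = Π¹-dropTrash μ p

  Π²-dropTrash : ∀ N μ → C.Π¹ μ (inj₂ N) ≡ 0 → ∀ i → S.Π² N (dropTrash μ) i ≡ C.Π² N μ i
  Π²-dropTrash N []                  _ i = refl
  Π²-dropTrash N ((inj₁ q , m) ∷ μ) noTrash i with d q Fin.≟ N
  ... | yes refl = cong (lookup m i +_) (Π²-dropTrash N μ noTrash i)
  ... | no _     = Π²-dropTrash N μ noTrash i
  Π²-dropTrash N ((inj₂ M , m) ∷ μ) noTrash i with M Fin.≟ N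
  ... | yes refl with () ← noTrash
  ... | no _     = Π²-dropTrash N μ noTrash i

  FoCons-trash : ∀ t N → ¬ Destroys E t N → FoCons E t (inj₂ N) ≡ 0
  FoCons-trash t N ¬destroys with destroys? E t N
  ... | yes destroys = ⊥-elim (¬destroys destroys)
  ... | no _         = refl

  firesWith-dropTrash :
    ∀ {e μ lam rho μ'} → (∀ N → Destroys E (Event.tau e) N → SystemAutonomous E e) →
    (fires : C.FiresWith μ e lam rho μ') →
    let lam' = clear (destroys? E (Event.tau e)) (dropTrash lam) in
    S.FiresWith (lam' ++ dropTrash (C.FiresWith.rest fires)) e lam' (dropTrash rho) (dropTrash μ')
  firesWith-dropTrash {ev t θ} {lam = lam} {rho} autonomous fires = record
    { rest     = dropTrash rest
    ; sub      = ↭-refl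
    ; result   = dropTrash-↭-++ {lam = rho} result
    ; sys-pre  = λ p → trans (Π¹-clear (destroys? E t) (dropTrash lam) p)
                             (trans (Π¹-dropTrash lam p) (sys-pre (inj₁ p)))
    ; sys-post = λ p → trans (Π¹-dropTrash rho p) (sys-post (inj₁ p))
    ; obj-en   = enabled
    ; obj-eff  = effect
    }
    where
    open C.FiresWith fires
    lam' : S.Config
    lam' = clear (destroys? E t) (dropTrash lam)

    Π²-lam : ∀ {N} → ¬ Destroys E t N → ∀ i → S.Π² N lam' i ≡ C.Π² N lam i
    Π²-lam {N} ¬destroys i =
      trans (Π²-clear-∉ (destroys? E t) N ¬destroys (dropTrash lam) i)
            (Π²-dropTrash N lam (sys-pre (inj₂ N)) i)

    Π²-rho : ∀ {N} → ¬ Destroys E t N → ∀ i → S.Π² N (dropTrash rho) i ≡ C.Π² N rho i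
    Π²-rho {N} ¬destroys =
      Π²-dropTrash N rho (trans (sys-post (inj₂ N)) (FoCons-trash t N ¬destroys))

    Π²-rho-destroyed : ∀ {N} → Destroys E t N → ∀ i → S.Π² N (dropTrash rho) i ≡ 0
    Π²-rho-destroyed {N} (_ , no-output) =
      Π¹≡0⇒Π²≡0 N (dropTrash rho)
        (λ q dq≡N → trans (Π¹-dropTrash rho q) (trans (sys-post (inj₁ q)) (no-output q dq≡N)))

    enabled : ∀ N i → preM N (θ N) i ≤ S.Π² N lam' i
    effect : ∀ N i → S.Π² N (dropTrash rho) i ≡ (S.Π² N lam' i ∸ preM N (θ N) i) + postM N (θ N) i

    enabled N i with destroys? E t N
    ... | yes destroys rewrite preM-zero obj N (θ N) (autonomous N destroys N) i = z≤n
    ... | no ¬destroys rewrite Π²-lam ¬destroys i = obj-en N i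
    effect N i with destroys? E t N
    ... | yes destroys
      rewrite preM-zero obj N (θ N) (autonomous N destroys N) i
            | postM-zero obj N (θ N) (autonomous N destroys N) i
            | Π²-clear-∈ (destroys? E t) N destroys (dropTrash lam) i
            | Π²-rho-destroyed destroys i = refl
    ... | no ¬destroys rewrite Π²-lam ¬destroys i | Π²-rho ¬destroys i = obj-eff N i

lemma7 : (E : EOS) → StandingAssumptions E →
         (i : Fin (EOS.ne E)) →
         (m m' : Sem.Config E) (k : SemCons.Config E) →
         OverTrash E k →
         SemCons._─[_]→_ E (embed E m) (EOS.Θ E i) (embed E m' ++ k) →
         ∃[ m'' ] (Sem._≤f_ E m'' m × Sem._─[_]→_ E m'' (EOS.Θ E i) m')
lemma7 E (_ , autonomous) i m m' k k-trash (lam , rho , fires) =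
  lam' ++ dropTrash E rest ,
  ≤f-clear (destroys? E t) {lam = dropTrash E lam} m↭ ,
  lam' , dropTrash E rho ,
  subst (Sem.FiresWith E _ (Θ i) lam' (dropTrash E rho)) (dropTrash-embed-++ E m' k k-trash)
        (firesWith-dropTrash E (autonomous i) fires)
  where
  open EOS E
  open SemanticsProperties obj Fin._≟_ d Fi Fo
  open SemCons.FiresWith E fires using (rest; sub)
  t : Fin nt
  t = Event.tau (Θ i)

  lam' : Sem.Config E
  lam' = clear (destroys? E t) (dropTrash E lam)

  m↭ : m ↭ dropTrash E lam ++ dropTrash E rest
  m↭ = subst (_↭ _) (dropTrash-embed E m) (dropTrash-↭-++ E {lam = lam} sub)
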